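{- Let $P$ be a mock partial field with associated morphism $\pi_P:P\to\Pi(P)$. Then for every morphism of pastures $f:P\to Q$ into a partial field $Q$, there is a unique morphism $\bar f:\Pi(P)\to Q$ such that $f=\bar f\circ\pi_P$. In other words, $\pi_P$ defines a reflection $\Pi$ from the category of mock partial fields to the category of partial fields.
   Context: A pasture is a commutative monoid $P$ (written multiplicatively) with an absorbing element $0$ such that $P^\times=P\setminus\{0\}$ is a group, together with a nullset $N_P\subseteq\mathrm{Sym}_3(P)$ ($P^3$ modulo permutations, class of $(a,b,c)$ written $a+b+c$) such that $a+0+0\in N_P$ iff $a=0$, $N_P$ is stable under multiplication by elements of $P^\times$, and there is a unique $-1\in P^\times$ with $1+(-1)+0\in N_P$. Morphisms are multiplicative maps preserving $0$, $1$ and nullsets. The universal ring of $P$ is $R_P=\mathbb Z[P^\times]/\langle N_P\rangle$, where $0\in P$ is identified with $0$ of the group ring and $\langle N_P\rangle$ is the ideal generated by all $a+b+c$ with $a+b+c\in N_P$; there is a natural multiplicative map $P\to R_P$. A pasture $P$ is a partial field if $P\to R_P$ is injective and every $a+b+c\in\mathrm{Sym}_3(P)$ that vanishes in $R_P$ lies in $N_P$ (equivalently, $P$ is the pasture $G\cup\{0\}$ associated with a pair $(G,R)$ of a ring $R$ and a subgroup $-1\in G\le R^\times$, with nullset all $a+b+c$ vanishing in $R$). A mock partial field is a pasture $P$ with $R_P\ne0$. For a mock partial field $P$, its associated partial field $\Pi(P)$ is the partial field $(G,R_P)$ where $G$ is the image of $P^\times\to R_P$, i.e. the pasture $G\cup\{0\}$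 with nullset all $a+b+c$ ($a,b,c\in G\cup\{0\}$) with $a+b+c=0$ in $R_P$; the natural map induces a surjective morphism $\pi_P:P\to\Pi(P)$. -}

module Defs where

open import Level using (Level; _⊔_; suc)
open import Data.Product using (Σ; _×_; _,_; proj₁; proj₂)
open import Relation.Nullary using (¬_)
open import Relation.Binary using (IsEquivalence; Setoid)
import Relation.Binary.Reasoning.Setoid as SetoidReasoning

-- The nullset N_P ⊆ Sym₃(P) is represented by a ternary predicate
-- N a b c ("a + b + c ∈ N_P") that is invariant under permutations of
-- its arguments (generated by two transpositions) and respects _≈_.

record Pasture (c ℓ : Level) : Set (suc (c ⊔ ℓ)) where
  infixl 7 _·_
  infix  4 _≈_
  field
    Carrier : Set c
    _≈_     : Carrier → Carrier → Set ℓ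
    isEquivalence : IsEquivalence _≈_
    _·_     : Carrier → Carrier → Carrier
    1#      : Carrier
    0#      : Carrier
    ·-cong  : ∀ {a a' b b'} → a ≈ a' → b ≈ b' → a · b ≈ a' · b'
    ·-assoc : ∀ a b c → (a · b) · c ≈ a · (b · c)
    ·-comm  : ∀ a b → a · b ≈ b · a
    ·-identityˡ : ∀ a → 1# · a ≈ a
    ·-zeroˡ : ∀ a → 0# · a ≈ 0#
    1≉0     : ¬ (1# ≈ 0#)
    ·-closed : ∀ a b → ¬ (a ≈ 0#) → ¬ (b ≈ 0#) → ¬ (a · b ≈ 0#)
    inverse : ∀ a → ¬ (a ≈ 0#) → Σ Carrier λ b → a · b ≈ 1#
    N       : Carrier → Carrier → Carrier → Set ℓ
    N-resp  : ∀ {a a' b b' c c'} → a ≈ a' → b ≈ b' → c ≈ c' → N a b c → N a' b' c'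
    N-swap₁₂ : ∀ {a b c} → N a b c → N b a c
    N-swap₂₃ : ∀ {a b c} → N a b c → N a c b
    N-zero⇒ : ∀ {a} → N a 0# 0# → a ≈ 0#
    N-zero⇐ : ∀ {a} → a ≈ 0# → N a 0# 0#
    N-unit  : ∀ {a b c} u → ¬ (u ≈ 0#) → N a b c → N (u · a) (u · b) (u · c)
    minus-one : Σ Carrier λ m → (¬ (m ≈ 0#)) × N 1# m 0# ×
                  (∀ m' → ¬ (m' ≈ 0#) → N 1# m' 0# → m' ≈ m)

record Morphism {c₁ ℓ₁ c₂ ℓ₂} (P : Pasture c₁ ℓ₁) (Q : Pasture c₂ ℓ₂)
       : Set (c₁ ⊔ ℓ₁ ⊔ c₂ ⊔ ℓ₂) where
  private
    module P = Pasture P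
    module Q = Pasture Q
  field
    fun      : P.Carrier → Q.Carrier
    fun-cong  : ∀ {a b} → a P.≈ b → fun a Q.≈ fun b
    fun-0     : fun P.0# Q.≈ Q.0#
    fun-1     : fun P.1# Q.≈ Q.1#
    fun-·     : ∀ a b → fun (a P.· b) Q.≈ fun a Q.· fun b
    fun-N     : ∀ {a b c} → P.N a b c → Q.N (fun a) (fun b) (fun c)

open Morphism public

-- The universal ring R_P = ℤ[P^×] / ⟨N_P⟩ (with 0 ∈ P identified with 0),
-- given by its presentation: the commutative ring freely generated by
-- the elements of P subject to the multiplicative relations of P,
-- [0] = 0, [1] = 1, and a + b + c = 0 for every a + b + c ∈ N_P.

module Universal {c ℓ} (P : Pasture c ℓ) where
  open Pasture P

  infixl 6 _⊕_
  infixl 7 _⊗_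
  infix  4 _≈R_

  data Expr : Set c where
    [_] : Carrier → Expr
    𝟘 𝟙 : Expr
    _⊕_ _⊗_ : Expr → Expr → Expr
    ⊖_ : Expr → Expr

  data _≈R_ : Expr → Expr → Set (c ⊔ ℓ) where
    R-refl  : ∀ {x} → x ≈R x
    R-sym   : ∀ {x y} → x ≈R y → y ≈R x
    R-trans : ∀ {x y z} → x ≈R y → y ≈R z → x ≈R z
    ⊕-cong  : ∀ {x x' y y'} → x ≈R x' → y ≈R y' → x ⊕ y ≈R x' ⊕ y'
    ⊗-cong  : ∀ {x x' y y'} → x ≈R x' → y ≈R y' → x ⊗ y ≈R x' ⊗ y'
    ⊖-cong  : ∀ {x x'} → x ≈R x' → ⊖ x ≈R ⊖ x'
    ⊕-assoc : ∀ x y z → (x ⊕ y) ⊕ z ≈R x ⊕ (y ⊕ z)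
    ⊕-comm  : ∀ x y → x ⊕ y ≈R y ⊕ x
    ⊕-idˡ   : ∀ x → 𝟘 ⊕ x ≈R x
    ⊖-invˡ  : ∀ x → (⊖ x) ⊕ x ≈R 𝟘
    ⊗-assoc : ∀ x y z → (x ⊗ y) ⊗ z ≈R x ⊗ (y ⊗ z)
    ⊗-comm  : ∀ x y → x ⊗ y ≈R y ⊗ x
    ⊗-idˡ   : ∀ x → 𝟙 ⊗ x ≈R x
    distribˡ : ∀ x y z → x ⊗ (y ⊕ z) ≈R (x ⊗ y) ⊕ (x ⊗ z)
    gen-cong : ∀ {a b} → a ≈ b → [ a ] ≈R [ b ]
    gen-·    : ∀ a b → [ a · b ] ≈R [ a ] ⊗ [ b ]
    gen-1    : [ 1# ] ≈R 𝟙
    gen-0    : [ 0# ] ≈R 𝟘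
    gen-N    : ∀ {a b c} → N a b c → [ a ] ⊕ [ b ] ⊕ [ c ] ≈R 𝟘

  R-setoid : Setoid c (c ⊔ ℓ)
  R-setoid = record
    { Carrier = Expr ; _≈_ = _≈R_
    ; isEquivalence = record { refl = R-refl ; sym = R-sym ; trans = R-trans } }

IsPartialField : ∀ {c ℓ} → Pasture c ℓ → Set (c ⊔ ℓ)
IsPartialField P =
  (∀ a b → [ a ] ≈R [ b ] → a ≈ b) ×
  (∀ a b c → [ a ] ⊕ [ b ] ⊕ [ c ] ≈R 𝟘 → N a b c)
  where open Pasture P
        open Universal P

IsMockPartialField : ∀ {c ℓ} → Pasture c ℓ → Set (c ⊔ ℓ)
IsMockPartialField P = ¬ (𝟙 ≈R 𝟘)
  where open Universal P

-- Its carrier is the image G ∪ {0} of P in R_P; we represent it by the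
-- elements of P, with a ~ b iff [a] = [b] in R_P, and nullset all
-- a + b + c with [a] + [b] + [c] = 0 in R_P.

module Assoc {c ℓ} (P : Pasture c ℓ) (mock : IsMockPartialField P) where
  open Pasture P
  open Universal P
  open SetoidReasoning R-setoid

  private
    ≈-refl : ∀ {a} → a ≈ a
    ≈-refl = IsEquivalence.refl isEquivalence

    _~_ : Carrier → Carrier → Set (c ⊔ ℓ)
    a ~ b = [ a ] ≈R [ b ]

    N' : Carrier → Carrier → Carrier → Set (c ⊔ ℓ)
    N' a b c = [ a ] ⊕ [ b ] ⊕ [ c ] ≈R 𝟘

    ⊕-idʳ : ∀ x → x ⊕ 𝟘 ≈R x
    ⊕-idʳ x = R-trans (⊕-comm x 𝟘) (⊕-idˡ x)

    ⊗-zeroˡ : ∀ x → 𝟘 ⊗ x ≈R 𝟘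
    ⊗-zeroˡ x = begin
      𝟘 ⊗ x                                  ≈⟨ R-sym (⊕-idˡ _) ⟩
      𝟘 ⊕ 𝟘 ⊗ x                              ≈⟨ ⊕-cong (R-sym (⊖-invˡ (𝟘 ⊗ x))) R-refl ⟩
      (⊖ (𝟘 ⊗ x)) ⊕ 𝟘 ⊗ x ⊕ 𝟘 ⊗ x            ≈⟨ ⊕-assoc _ _ _ ⟩
      (⊖ (𝟘 ⊗ x)) ⊕ (𝟘 ⊗ x ⊕ 𝟘 ⊗ x)          ≈⟨ ⊕-cong R-refl lem ⟩
      (⊖ (𝟘 ⊗ x)) ⊕ 𝟘 ⊗ x                    ≈⟨ ⊖-invˡ _ ⟩
      𝟘 ∎
      where
      lem : 𝟘 ⊗ x ⊕ 𝟘 ⊗ x ≈R 𝟘 ⊗ x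
      lem = begin
        𝟘 ⊗ x ⊕ 𝟘 ⊗ x    ≈⟨ ⊕-cong (⊗-comm _ _) (⊗-comm _ _) ⟩
        x ⊗ 𝟘 ⊕ x ⊗ 𝟘    ≈⟨ R-sym (distribˡ _ _ _) ⟩
        x ⊗ (𝟘 ⊕ 𝟘)      ≈⟨ ⊗-cong R-refl (⊕-idˡ 𝟘) ⟩
        x ⊗ 𝟘            ≈⟨ ⊗-comm _ _ ⟩
        𝟘 ⊗ x ∎

    ⊗-idʳ : ∀ x → x ⊗ 𝟙 ≈R x
    ⊗-idʳ x = R-trans (⊗-comm x 𝟙) (⊗-idˡ x)

    neg-unique : ∀ {x y z} → x ⊕ y ≈R 𝟘 → x ⊕ z ≈R 𝟘 → y ≈R z
    neg-unique {x} {y} {z} p q = begin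
      y                ≈⟨ R-sym (⊕-idʳ y) ⟩
      y ⊕ 𝟘            ≈⟨ ⊕-cong R-refl (R-sym q) ⟩
      y ⊕ (x ⊕ z)      ≈⟨ R-sym (⊕-assoc _ _ _) ⟩
      (y ⊕ x) ⊕ z      ≈⟨ ⊕-cong (R-trans (⊕-comm y x) p) R-refl ⟩
      𝟘 ⊕ z            ≈⟨ ⊕-idˡ z ⟩
      z ∎

    ~⇒≉ : ∀ {a} → ¬ (a ~ 0#) → ¬ (a ≈ 0#)
    ~⇒≉ p q = p (gen-cong q)

    swap₁₂ : ∀ x y z → x ⊕ y ⊕ z ≈R y ⊕ x ⊕ z
    swap₁₂ x y z = ⊕-cong (⊕-comm x y) R-refl

    swap₂₃ : ∀ x y z → x ⊕ y ⊕ z ≈R x ⊕ z ⊕ y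
    swap₂₃ x y z = begin
      x ⊕ y ⊕ z    ≈⟨ ⊕-assoc _ _ _ ⟩
      x ⊕ (y ⊕ z)  ≈⟨ ⊕-cong R-refl (⊕-comm y z) ⟩
      x ⊕ (z ⊕ y)  ≈⟨ R-sym (⊕-assoc _ _ _) ⟩
      x ⊕ z ⊕ y ∎

    scale : ∀ u x y z → u ⊗ x ⊕ u ⊗ y ⊕ u ⊗ z ≈R u ⊗ (x ⊕ y ⊕ z)
    scale u x y z = begin
      u ⊗ x ⊕ u ⊗ y ⊕ u ⊗ z    ≈⟨ ⊕-cong (R-sym (distribˡ _ _ _)) R-refl ⟩
      u ⊗ (x ⊕ y) ⊕ u ⊗ z      ≈⟨ R-sym (distribˡ _ _ _) ⟩
      u ⊗ (x ⊕ y ⊕ z) ∎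

    N'-unit : ∀ {a b c} u → ¬ (u ~ 0#) → N' a b c → N' (u · a) (u · b) (u · c)
    N'-unit {a} {b} {c} u _ n = begin
      [ u · a ] ⊕ [ u · b ] ⊕ [ u · c ]
        ≈⟨ ⊕-cong (⊕-cong (gen-· u a) (gen-· u b)) (gen-· u c) ⟩
      [ u ] ⊗ [ a ] ⊕ [ u ] ⊗ [ b ] ⊕ [ u ] ⊗ [ c ]
        ≈⟨ scale _ _ _ _ ⟩
      [ u ] ⊗ ([ a ] ⊕ [ b ] ⊕ [ c ])
        ≈⟨ ⊗-cong R-refl n ⟩
      [ u ] ⊗ 𝟘
        ≈⟨ R-trans (⊗-comm _ _) (⊗-zeroˡ _) ⟩
      𝟘 ∎

    zz : ∀ a → [ a ] ⊕ [ 0# ] ⊕ [ 0# ] ≈R [ a ]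
    zz a = R-trans (⊕-cong (⊕-cong R-refl gen-0) gen-0)
                   (R-trans (⊕-idʳ _) (⊕-idʳ _))

    closed : ∀ a b → ¬ (a ~ 0#) → ¬ (b ~ 0#) → ¬ ((a · b) ~ 0#)
    closed a b na nb ab0 with inverse b (~⇒≉ nb)
    ... | b' , bb' = na (begin
      [ a ]                     ≈⟨ R-sym (⊗-idʳ _) ⟩
      [ a ] ⊗ 𝟙                 ≈⟨ ⊗-cong R-refl (R-sym (R-trans (gen-cong bb') gen-1)) ⟩
      [ a ] ⊗ [ b · b' ]        ≈⟨ ⊗-cong R-refl (gen-· b b') ⟩
      [ a ] ⊗ ([ b ] ⊗ [ b' ])  ≈⟨ R-sym (⊗-assoc _ _ _) ⟩
      ([ a ] ⊗ [ b ]) ⊗ [ b' ]  ≈⟨ ⊗-cong (R-sym (gen-· a b)) R-refl ⟩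
      [ a · b ] ⊗ [ b' ]        ≈⟨ ⊗-cong ab0 R-refl ⟩
      [ 0# ] ⊗ [ b' ]           ≈⟨ ⊗-cong gen-0 R-refl ⟩
      𝟘 ⊗ [ b' ]                ≈⟨ ⊗-zeroˡ _ ⟩
      𝟘                         ≈⟨ R-sym gen-0 ⟩
      [ 0# ] ∎)

    m : Carrier
    m = proj₁ minus-one

    Nm : N 1# m 0#
    Nm = proj₁ (proj₂ (proj₂ minus-one))

    drop0 : ∀ x y → x ⊕ y ⊕ [ 0# ] ≈R x ⊕ y
    drop0 x y = R-trans (⊕-cong R-refl gen-0) (⊕-idʳ _)

    minus-one' : Σ Carrier λ m' → (¬ (m' ~ 0#)) × N' 1# m' 0# ×
                   (∀ m'' → ¬ (m'' ~ 0#) → N' 1# m'' 0# → m'' ~ m')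
    minus-one' = m , m≁0 , gen-N Nm , uniq
      where
      m≁0 : ¬ (m ~ 0#)
      m≁0 p = mock (begin
        𝟙                        ≈⟨ R-sym gen-1 ⟩
        [ 1# ]                   ≈⟨ R-sym (zz 1#) ⟩
        [ 1# ] ⊕ [ 0# ] ⊕ [ 0# ] ≈⟨ ⊕-cong (⊕-cong R-refl (R-sym p)) R-refl ⟩
        [ 1# ] ⊕ [ m ] ⊕ [ 0# ]  ≈⟨ gen-N Nm ⟩
        𝟘 ∎)
      uniq : ∀ m'' → ¬ (m'' ~ 0#) → N' 1# m'' 0# → m'' ~ m
      uniq m'' _ n = neg-unique (R-trans (R-sym (drop0 _ _)) n)
                                (R-trans (R-sym (drop0 _ _)) (gen-N Nm))

  Π : Pasture c (c ⊔ ℓ)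
  Π = record
    { Carrier = Carrier
    ; _≈_ = _~_
    ; isEquivalence = record { refl = R-refl ; sym = R-sym ; trans = R-trans }
    ; _·_ = _·_
    ; 1# = 1#
    ; 0# = 0#
    ; ·-cong = λ {a} {a'} {b} {b'} p q →
        R-trans (gen-· a b) (R-trans (⊗-cong p q) (R-sym (gen-· a' b')))
    ; ·-assoc = λ a b c → gen-cong (·-assoc a b c)
    ; ·-comm = λ a b → gen-cong (·-comm a b)
    ; ·-identityˡ = λ a → gen-cong (·-identityˡ a)
    ; ·-zeroˡ = λ a → gen-cong (·-zeroˡ a)
    ; 1≉0 = λ p → mock (R-trans (R-sym gen-1) (R-trans p gen-0))
    ; ·-closed = closed
    ; inverse = λ a na → let (b , ab) = inverse a (~⇒≉ na) in b , gen-cong ab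
    ; N = N'
    ; N-resp = λ p q r n → R-trans (⊕-cong (⊕-cong (R-sym p) (R-sym q)) (R-sym r)) n
    ; N-swap₁₂ = λ n → R-trans (swap₁₂ _ _ _) n
    ; N-swap₂₃ = λ n → R-trans (swap₂₃ _ _ _) n
    ; N-zero⇒ = λ {a} n → R-trans (R-sym (zz a)) (R-trans n (R-sym gen-0))
    ; N-zero⇐ = λ {a} p → R-trans (zz a) (R-trans p gen-0)
    ; N-unit = N'-unit
    ; minus-one = minus-one'
    }

  π : Morphism P Π
  π = record
    { fun = λ a → a
    ; fun-cong = gen-cong
    ; fun-0 = R-refl
    ; fun-1 = R-refl
    ; fun-· = λ _ _ → R-refl
    ; fun-N = gen-N
    }

Π[_,_] : ∀ {c ℓ} (P : Pasture c ℓ) → IsMockPartialField P → Pasture c (c ⊔ ℓ)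
Π[ P , mock ] = Assoc.Π P mock

π[_,_] : ∀ {c ℓ} (P : Pasture c ℓ) (mock : IsMockPartialField P) →
         Morphism P Π[ P , mock ]
π[ P , mock ] = Assoc.π P mock

module Submission where

open import Defs
open import Data.Product using (Σ; _×_; _,_)
open import Relation.Binary using (IsEquivalence)

-- A morphism f : P → Q sends each defining relation of R_P to a relation of R_Q,
-- so it induces a ring map R_P → R_Q. When Q is a partial field, equalities and
-- vanishing three-term sums in R_Q descend to Q, hence f is already a morphism
-- on Π(P), whose underlying elements are those of P. Uniqueness holds because
-- π_P is the identity on underlying elements.

module _ {c ℓ c' ℓ'} {P : Pasture c ℓ} {Q : Pasture c' ℓ'} (f : Morphism P Q) where
  private
    module UP = Universal P
    module UQ = Universal Q

  universal-map : UP.Expr → UQ.Expr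
  universal-map UP.[ a ]   = UQ.[ fun f a ]
  universal-map UP.𝟘       = UQ.𝟘
  universal-map UP.𝟙       = UQ.𝟙
  universal-map (x UP.⊕ y) = universal-map x UQ.⊕ universal-map y
  universal-map (x UP.⊗ y) = universal-map x UQ.⊗ universal-map y
  universal-map (UP.⊖ x)   = UQ.⊖ universal-map x

  universal-map-cong : ∀ {x y} → x UP.≈R y → universal-map x UQ.≈R universal-map y
  universal-map-cong UP.R-refl             = UQ.R-refl
  universal-map-cong (UP.R-sym p)          = UQ.R-sym (universal-map-cong p)
  universal-map-cong (UP.R-trans p q)      = UQ.R-trans (universal-map-cong p) (universal-map-cong q)
  universal-map-cong (UP.⊕-cong p q)       = UQ.⊕-cong (universal-map-cong p) (universal-map-cong q)
  universal-map-cong (UP.⊗-cong p q)       = UQ.⊗-cong (universal-map-cong p) (universal-map-cong q)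
  universal-map-cong (UP.⊖-cong p)         = UQ.⊖-cong (universal-map-cong p)
  universal-map-cong (UP.⊕-assoc x y z)    = UQ.⊕-assoc _ _ _
  universal-map-cong (UP.⊕-comm x y)       = UQ.⊕-comm _ _
  universal-map-cong (UP.⊕-idˡ x)          = UQ.⊕-idˡ _
  universal-map-cong (UP.⊖-invˡ x)         = UQ.⊖-invˡ _
  universal-map-cong (UP.⊗-assoc x y z)    = UQ.⊗-assoc _ _ _
  universal-map-cong (UP.⊗-comm x y)       = UQ.⊗-comm _ _
  universal-map-cong (UP.⊗-idˡ x)          = UQ.⊗-idˡ _
  universal-map-cong (UP.distribˡ x y z)   = UQ.distribˡ _ _ _
  universal-map-cong (UP.gen-cong p)       = UQ.gen-cong (fun-cong f p)
  universal-map-cong (UP.gen-· a b)        = UQ.R-trans (UQ.gen-cong (fun-· f a b)) (UQ.gen-· _ _)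
  universal-map-cong UP.gen-1              = UQ.R-trans (UQ.gen-cong (fun-1 f)) UQ.gen-1
  universal-map-cong UP.gen-0              = UQ.R-trans (UQ.gen-cong (fun-0 f)) UQ.gen-0
  universal-map-cong (UP.gen-N n)          = UQ.gen-N (fun-N f n)

Π-lift : ∀ {c ℓ c' ℓ'} {P : Pasture c ℓ} (mock : IsMockPartialField P)
         {Q : Pasture c' ℓ'} → IsPartialField Q → Morphism P Q →
         Morphism Π[ P , mock ] Q
Π-lift mock (injective , null-reflecting) f = record
  { fun      = fun f
  ; fun-cong = λ p → injective _ _ (universal-map-cong f p)
  ; fun-0    = fun-0 f
  ; fun-1    = fun-1 f
  ; fun-·    = fun-· f
  ; fun-N    = λ n → null-reflecting _ _ _ (universal-map-cong f n)
  }

lemma2p14 : ∀ {c ℓ c' ℓ'} (P : Pasture c ℓ) (mock : IsMockPartialField P)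
              (Q : Pasture c' ℓ') → IsPartialField Q → (f : Morphism P Q) →
              Σ (Morphism Π[ P , mock ] Q) λ fbar →
                (∀ a → Pasture._≈_ Q (fun f a) (fun fbar (fun π[ P , mock ] a))) ×
                (∀ (g : Morphism Π[ P , mock ] Q) →
                   (∀ a → Pasture._≈_ Q (fun f a) (fun g (fun π[ P , mock ] a))) →
                   ∀ x → Pasture._≈_ Q (fun g x) (fun fbar x))
lemma2p14 P mock Q isPartialField f =
  Π-lift mock isPartialField f , (λ _ → refl) , λ g f≈g∘π x → sym (f≈g∘π x)
  where open IsEquivalence (Pasture.isEquivalence Q)
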